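{- Let $D$ be a digraph on $\{1,\dots,n\}$, $q\ge2$, $f\in F[D,q]$ and $\sigma$ a block-sequential schedule. Then $\operatorname{ima}(f^\sigma)\le\alpha_1(D)$.
   Context: A digraph $D=(V,E)$ has $V=\{1,\dots,n\}$, $E\subseteq V^2$ (loops allowed). $\alpha_1(D)$ is the maximum number of pairwise independent arcs, where arcs $(u,v),(u',v')$ are independent if $u\ne u'$ and $v\ne v'$. With $[q]=\{0,\dots,q-1\}$, for $f:[q]^n\to[q]^n$, $\mathrm{IG}(f)$ is the digraph on $V$ with $(u,v)$ an arc iff $f_v$ depends essentially on $x_u$; $F[D,q]=\{f:\mathrm{IG}(f)=D\}$. A schedule is a sequence $\sigma=(\sigma_1,\dots,\sigma_t)$ of subsets of $V$. For $S\subseteq V$, $f^{(S)}:[q]^n\to[q]^n$ is given by $f^{(S)}_v(x)=f_v(x)$ if $v\in S$ and $f^{(S)}_v(x)=x_v$ otherwise; $f^\sigma=f^{(\sigma_t)}\circ\dots\circ f^{(\sigma_1)}$. $\sigma$ is block-sequential if $\bigcup_i\sigma_i=V$ and $\sigma_i\cap\sigma_j=\emptyset$ for $i\ne j$. $\operatorname{ima}(g)=\log_q|\mathrm{Im}(g)|$. -}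

module Defs where

open import Data.Nat using (ℕ; zero; suc; _≤_; _^_)
open import Data.Fin using (Fin; _≟_)
open import Data.Fin.Subset using (Subset; _∈_)
open import Data.Bool using (if_then_else_)
open import Data.Vec using (Vec; []; _∷_; lookup; _[_]≔_)
import Data.Vec.Properties as VecP
open import Data.List using (List; []; _∷_; map; concatMap; filter; length)
open import Data.List.Relation.Unary.All using (All)
open import Data.List.Relation.Unary.Any using (Any; any?)
open import Data.List.Relation.Unary.AllPairs using (AllPairs)
open import Data.Product using (Σ; _×_; _,_; ∃; ∃-syntax)
open import Relation.Binary.PropositionalEquality using (_≡_; _≢_)
open import Relation.Nullary using (¬_)

State : ℕ → ℕ → Set
State q n = Vec (Fin q) n

Digraph : ℕ → Set₁
Digraph n = Fin n → Fin n → Set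

DependsOn : ∀ {q n} → (State q n → State q n) → Fin n → Fin n → Set
DependsOn f u v = ∃[ x ] ∃[ a ] (lookup (f x) v ≢ lookup (f (x [ u ]≔ a)) v)

HasInteractionGraph : ∀ {q n} → (State q n → State q n) → Digraph n → Set
HasInteractionGraph f D = ∀ u v → (D u v → DependsOn f u v) × (DependsOn f u v → D u v)

Independent : ∀ {n} → Fin n × Fin n → Fin n × Fin n → Set
Independent (u , v) (u' , v') = (u ≢ u') × (v ≢ v')

IndependentArcs : ∀ {n} → Digraph n → List (Fin n × Fin n) → Set
IndependentArcs D L = All (λ { (u , v) → D u v }) L × AllPairs Independent L

IsAlpha1 : ∀ {n} → Digraph n → ℕ → Set
IsAlpha1 D k = (∃[ L ] (IndependentArcs D L × length L ≡ k))
             × (∀ L → IndependentArcs D L → length L ≤ k)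

update : ∀ {q n} → (State q n → State q n) → Subset n → State q n → State q n
update f S x = go S x (f x)
  where
  go : ∀ {m} → Subset m → State _ m → State _ m → State _ m
  go [] [] [] = []
  go (b ∷ S) (xv ∷ xs) (fv ∷ fs) = (if b then fv else xv) ∷ go S xs fs

applySchedule : ∀ {q n t} → (State q n → State q n) → Vec (Subset n) t → State q n → State q n
applySchedule f [] x = x
applySchedule f (S ∷ σ) x = applySchedule f σ (update f S x)

BlockSequential : ∀ {n t} → Vec (Subset n) t → Set
BlockSequential {n} {t} σ =
  (∀ (v : Fin n) → ∃[ i ] (v ∈ lookup σ i))
  × (∀ (i j : Fin t) (v : Fin n) → v ∈ lookup σ i → v ∈ lookup σ j → i ≡ j)

allStates : ∀ q n → List (State q n)
allStates q zero = [] ∷ []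
allStates q (suc n) = concatMap (λ a → map (a ∷_) (allStates q n)) (Data.List.allFin q)

imageSize : ∀ {q n} → (State q n → State q n) → ℕ
imageSize {q} {n} g =
  length (filter (λ y → any? (λ x → VecP.≡-dec _≟_ (g x) y) (allStates q n)) (allStates q n))

-- Read D as a bipartite graph from tails to heads. By König's theorem its arcs
-- are covered by a set A of tails and a set B of heads with |A| + |B| ≤ α₁(D).
-- Every in-neighbour of a vertex v ∉ B lies in A, so f_v reads only coordinates
-- in A. Along a block-sequential schedule every vertex is updated exactly once.
-- If x = y on A and f^σ(x) = f^σ(y) on B, then by induction over the blocks the
-- two runs stay equal on A and on every vertex updated so far: an updated vertex
-- of B already has its final value, and one outside B is computed from A. So
-- f^σ(x) is determined by x on A and f^σ(x) on B, and
-- |Im f^σ| ≤ q^(|A|+|B|) ≤ q^α₁(D).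
module Submission where

open import Defs
open import Data.Nat using (ℕ; zero; suc; _+_; _*_; _^_; _≤_; _<_; z≤n; s≤s; _<?_; _≤?_; NonZero; >-nonZero)
open import Data.Nat.Properties hiding (_≟_)
open import Algebra.Properties.CommutativeSemigroup +-commutativeSemigroup using (interchange)
open import Data.Nat.Induction using (<-wellFounded)
open import Induction.WellFounded using (Acc; acc)
open import Data.Fin using (Fin; zero; suc; _≟_)
import Data.Fin.Properties as Fin
open import Data.Fin.Subset
  using (Subset; _∈_; _∉_; _⊆_; ⊤; ⊥; ⁅_⁆; _∪_; _─_; _-_; ∣_∣; Nonempty; inside; outside)
open import Data.Fin.Subset.Properties
open import Data.Vec using (Vec; []; _∷_; here; there; lookup; tabulate; _[_]≔_)
import Data.Vec.Properties as Vec
open import Data.Vec.Relation.Binary.Pointwise.Extensional using (ext; Pointwise-≡⇒≡)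
open import Data.List
  using (List; []; _∷_; _++_; length; map; concatMap; filter; allFin; mapMaybe;
         cartesianProductWith; cartesianProduct)
open import Data.List.Properties using (length-++; length-map; length-catMaybes; length-removeAt′; length-tabulate)
open import Data.List.Relation.Unary.All as All using (All; []; _∷_)
open import Data.List.Relation.Unary.All.Properties using (++⁺)
open import Data.List.Relation.Unary.Any as Any using (Any; here; there; any?)
open import Data.List.Relation.Unary.Any.Properties using (mapMaybe⁺; map⁺)
open import Data.List.Relation.Unary.AllPairs using (AllPairs; []; _∷_)
import Data.List.Relation.Unary.AllPairs.Properties as AllPairs
open import Data.List.Relation.Unary.Unique.Propositional using (Unique)
import Data.List.Relation.Unary.Unique.Propositional.Properties as Unique
open import Data.List.Membership.Propositional using (lose) renaming (_∈_ to _∈ₗ_)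
open import Data.List.Membership.Propositional.Properties
  using (∈-filter⁻; ∈-allFin; ∈-cartesianProductWith⁺; ∈-cartesianProduct⁺)
open import Data.Maybe using (Maybe; just; nothing)
import Data.Maybe.Relation.Unary.Any as Maybe
open import Data.Product using (∃; ∃-syntax; _×_; _,_; proj₁; proj₂)
open import Data.Product.Properties using (,-injective)
import Data.Product.Properties as Product
open import Data.Sum using (_⊎_; inj₁; inj₂; [_,_]′; map₂)
open import Function using (_∘_; id)
open import Relation.Unary using (Decidable)
open import Relation.Binary using (DecidableEquality)
open import Relation.Nullary using (¬_; Dec; yes; no; does; ¬?; contradiction)
open import Relation.Nullary.Decidable using (dec-true; _×-dec_; map′)
open import Relation.Binary.PropositionalEquality

private variable
  n : ℕ
  X : Set

-- Subsets of Fin n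

x∈p─q⇒x∉q : ∀ {x : Fin n} (p q : Subset n) → x ∈ p ─ q → x ∉ q
x∈p─q⇒x∉q (_ ∷ p) (outside ∷ q) here ()
x∈p─q⇒x∉q (_ ∷ p) (_ ∷ q) (there x∈p─q) (there x∈q) = x∈p─q⇒x∉q p q x∈p─q x∈q

∣p∣≡∣q∣+∣p─q∣ : ∀ (p q : Subset n) → q ⊆ p → ∣ p ∣ ≡ ∣ q ∣ + ∣ p ─ q ∣
∣p∣≡∣q∣+∣p─q∣ [] [] _ = refl
∣p∣≡∣q∣+∣p─q∣ (inside ∷ p) (inside ∷ q) q⊆p = cong suc (∣p∣≡∣q∣+∣p─q∣ p q (drop-∷-⊆ q⊆p))
∣p∣≡∣q∣+∣p─q∣ (inside ∷ p) (outside ∷ q) q⊆p =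
  trans (cong suc (∣p∣≡∣q∣+∣p─q∣ p q (drop-∷-⊆ q⊆p))) (sym (+-suc ∣ q ∣ ∣ p ─ q ∣))
∣p∣≡∣q∣+∣p─q∣ (outside ∷ p) (inside ∷ q) q⊆p = contradiction (q⊆p here) λ ()
∣p∣≡∣q∣+∣p─q∣ (outside ∷ p) (outside ∷ q) q⊆p = ∣p∣≡∣q∣+∣p─q∣ p q (drop-∷-⊆ q⊆p)

x∈p⇒∣p∣≡1+∣p-x∣ : ∀ {x : Fin n} (p : Subset n) → x ∈ p → ∣ p ∣ ≡ suc ∣ p - x ∣
x∈p⇒∣p∣≡1+∣p-x∣ {x = x} p x∈p =
  trans (∣p∣≡∣q∣+∣p─q∣ p ⁅ x ⁆ λ y∈⁅x⁆ → subst (_∈ p) (sym (x∈⁅y⁆⇒x≡y x y∈⁅x⁆)) x∈p)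
        (cong (_+ ∣ p - x ∣) (∣⁅x⁆∣≡1 x))

∣p∪q∣≤∣p∣+∣q∣ : ∀ (p q : Subset n) → ∣ p ∪ q ∣ ≤ ∣ p ∣ + ∣ q ∣
∣p∪q∣≤∣p∣+∣q∣ [] [] = z≤n
∣p∪q∣≤∣p∣+∣q∣ (inside ∷ p) (inside ∷ q) = s≤s (≤-trans (∣p∪q∣≤∣p∣+∣q∣ p q) (+-monoʳ-≤ ∣ p ∣ (n≤1+n ∣ q ∣)))
∣p∪q∣≤∣p∣+∣q∣ (inside ∷ p) (outside ∷ q) = s≤s (∣p∪q∣≤∣p∣+∣q∣ p q)
∣p∪q∣≤∣p∣+∣q∣ (outside ∷ p) (inside ∷ q) = ≤-trans (s≤s (∣p∪q∣≤∣p∣+∣q∣ p q)) (≤-reflexive (sym (+-suc ∣ p ∣ ∣ q ∣)))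
∣p∪q∣≤∣p∣+∣q∣ (outside ∷ p) (outside ∷ q) = ∣p∪q∣≤∣p∣+∣q∣ p q

∪-least : ∀ {p q r : Subset n} → p ⊆ r → q ⊆ r → p ∪ q ⊆ r
∪-least {p = p} {q = q} p⊆r q⊆r x∈p∪q = [ p⊆r , q⊆r ]′ (x∈p∪q⁻ p q x∈p∪q)

Disjoint : Subset n → Subset n → Set
Disjoint p q = ∀ {x} → x ∈ p → x ∉ q

disjoint⇒∣p∣+∣q∣≤∣p∪q∣ : ∀ (p q : Subset n) → Disjoint p q → ∣ p ∣ + ∣ q ∣ ≤ ∣ p ∪ q ∣
disjoint⇒∣p∣+∣q∣≤∣p∪q∣ [] [] _ = z≤n
disjoint⇒∣p∣+∣q∣≤∣p∪q∣ (inside ∷ p) (inside ∷ q) p#q = contradiction here (p#q here)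
disjoint⇒∣p∣+∣q∣≤∣p∪q∣ (inside ∷ p) (outside ∷ q) p#q =
  s≤s (disjoint⇒∣p∣+∣q∣≤∣p∪q∣ p q λ x∈p x∈q → p#q (there x∈p) (there x∈q))
disjoint⇒∣p∣+∣q∣≤∣p∪q∣ (outside ∷ p) (inside ∷ q) p#q =
  ≤-trans (≤-reflexive (+-suc ∣ p ∣ ∣ q ∣)) (s≤s (disjoint⇒∣p∣+∣q∣≤∣p∪q∣ p q λ x∈p x∈q → p#q (there x∈p) (there x∈q)))
disjoint⇒∣p∣+∣q∣≤∣p∪q∣ (outside ∷ p) (outside ∷ q) p#q =
  disjoint⇒∣p∣+∣q∣≤∣p∪q∣ p q λ x∈p x∈q → p#q (there x∈p) (there x∈q)

0<∣p∣⇒Nonempty : ∀ (p : Subset n) → 0 < ∣ p ∣ → Nonempty p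
0<∣p∣⇒Nonempty {n} p 0<∣p∣ with nonempty? p
... | yes p≢∅ = p≢∅
... | no p≡∅ = contradiction (trans (cong ∣_∣ (Empty-unique p≡∅)) (∣⊥∣≡0 n)) (>⇒≢ 0<∣p∣)

fromDec : ∀ {P : Fin n → Set} → Decidable P → Subset n
fromDec P? = tabulate (does ∘ P?)

∈-fromDec⁺ : ∀ {P : Fin n → Set} (P? : Decidable P) {x} → P x → x ∈ fromDec P?
∈-fromDec⁺ P? {x} px = Vec.lookup⇒[]= x _ (trans (Vec.lookup∘tabulate (does ∘ P?) x) (dec-true (P? x) px))

∈-fromDec⁻ : ∀ {P : Fin n → Set} (P? : Decidable P) {x} → x ∈ fromDec P? → P x
∈-fromDec⁻ P? {x} x∈ with P? x | trans (sym (Vec.lookup∘tabulate (does ∘ P?) x)) (Vec.[]=⇒lookup x∈)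
... | yes px | _ = px

-- König's theorem

module König {n : ℕ} (R : Digraph n) (R? : ∀ u v → Dec (R u v)) where

  IsNeighbour : Subset n → Subset n → Fin n → Set
  IsNeighbour V S v = v ∈ V × ∃[ u ] u ∈ S × R u v

  isNeighbour? : ∀ V S → Decidable (IsNeighbour V S)
  isNeighbour? V S v = v ∈? V ×-dec Fin.any? λ u → u ∈? S ×-dec R? u v

  neighbours : Subset n → Subset n → Subset n
  neighbours V S = fromDec (isNeighbour? V S)

  ∈-neighbours⁺ : ∀ {V S u v} → v ∈ V → u ∈ S → R u v → v ∈ neighbours V S
  ∈-neighbours⁺ {V} {S} {u} v∈V u∈S uRv = ∈-fromDec⁺ (isNeighbour? V S) (v∈V , u , u∈S , uRv)

  ∈-neighbours⁻ : ∀ {V S v} → v ∈ neighbours V S → IsNeighbour V S v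
  ∈-neighbours⁻ {V} {S} = ∈-fromDec⁻ (isNeighbour? V S)

  neighbours-restrict : ∀ {V S T} → T ⊆ S → neighbours V T ⊆ neighbours (neighbours V S) T
  neighbours-restrict T⊆S v∈N with ∈-neighbours⁻ v∈N
  ... | v∈V , u , u∈T , uRv = ∈-neighbours⁺ (∈-neighbours⁺ v∈V (T⊆S u∈T) uRv) u∈T uRv

  neighbours-⊆-∪ : ∀ {V T W} → neighbours V T ⊆ neighbours (V ─ W) T ∪ W
  neighbours-⊆-∪ {V} {T} {W} {v} v∈N with ∈-neighbours⁻ v∈N | v ∈? W
  ... | _ | yes v∈W = q⊆p∪q (neighbours (V ─ W) T) W v∈W
  ... | v∈V , u , u∈T , uRv | no v∉W =
    p⊆p∪q W (∈-neighbours⁺ (x∈p∧x∉q⇒x∈p─q v∈V v∉W) u∈T uRv)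

  neighbours-∪-⊆ : ∀ {V T S} → neighbours V (T ∪ S) ⊆ neighbours (V ─ neighbours V S) T ∪ neighbours V S
  neighbours-∪-⊆ {V} {T} {S} {v} v∈N with ∈-neighbours⁻ v∈N | v ∈? neighbours V S
  ... | _ | yes v∈NS = q⊆p∪q (neighbours (V ─ neighbours V S) T) _ v∈NS
  ... | v∈V , u , u∈T∪S , uRv | no v∉NS with x∈p∪q⁻ T S u∈T∪S
  ...   | inj₁ u∈T = p⊆p∪q _ (∈-neighbours⁺ (x∈p∧x∉q⇒x∈p─q v∈V v∉NS) u∈T uRv)
  ...   | inj₂ u∈S = contradiction (∈-neighbours⁺ v∈V u∈S uRv) v∉NS

  ArcIn : Subset n → Subset n → Fin n × Fin n → Set
  ArcIn U V e = proj₁ e ∈ U × proj₂ e ∈ V × R (proj₁ e) (proj₂ e)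

  Matching : Subset n → Subset n → List (Fin n × Fin n) → Set
  Matching U V M = All (ArcIn U V) M × AllPairs Independent M

  matching-mono : ∀ {U U′ V V′ M} → U ⊆ U′ → V ⊆ V′ → Matching U V M → Matching U′ V′ M
  matching-mono U⊆U′ V⊆V′ (arcs , indep) = All.map (λ (u∈ , v∈ , uRv) → U⊆U′ u∈ , V⊆V′ v∈ , uRv) arcs , indep

  matching-++ : ∀ {U₁ U₂ V₁ V₂ M₁ M₂} → Disjoint U₁ U₂ → Disjoint V₁ V₂
    → Matching U₁ V₁ M₁ → Matching U₂ V₂ M₂ → Matching (U₁ ∪ U₂) (V₁ ∪ V₂) (M₁ ++ M₂)
  matching-++ {U₁} {U₂} {V₁} {V₂} U₁#U₂ V₁#V₂ m₁@(arcs₁ , indep₁) m₂@(arcs₂ , indep₂) =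
    ++⁺ (proj₁ (matching-mono (p⊆p∪q U₂) (p⊆p∪q V₂) m₁)) (proj₁ (matching-mono (q⊆p∪q U₁ U₂) (q⊆p∪q V₁ V₂) m₂)) ,
    AllPairs.++⁺ indep₁ indep₂ (All.map (λ arc₁ → All.map (independent arc₁) arcs₂) arcs₁)
    where
    independent : ∀ {e₁ e₂} → ArcIn U₁ V₁ e₁ → ArcIn U₂ V₂ e₂ → Independent e₁ e₂
    independent {_ , _} {_ , _} (u₁∈ , v₁∈ , _) (u₂∈ , v₂∈ , _) =
      (λ { refl → U₁#U₂ u₁∈ u₂∈ }) , (λ { refl → V₁#V₂ v₁∈ v₂∈ })

  HallCondition : ℕ → Subset n → Subset n → Set
  HallCondition d U V = ∀ S → S ⊆ U → ∣ S ∣ ≤ ∣ neighbours V S ∣ + d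

  LargeMatching : ℕ → Subset n → Subset n → Set
  LargeMatching d U V = ∃[ M ] Matching U V M × ∣ U ∣ ≤ length M + d

  Critical : ℕ → Subset n → Subset n → Subset n → Set
  Critical d U V S = S ⊆ U × 0 < ∣ S ∣ × ∣ S ∣ < ∣ U ∣ × ∣ neighbours V S ∣ + d ≤ ∣ S ∣

  critical? : ∀ d U V → Decidable (Critical d U V)
  critical? d U V S = S ⊆? U ×-dec 0 <? ∣ S ∣ ×-dec ∣ S ∣ <? ∣ U ∣ ×-dec ∣ neighbours V S ∣ + d ≤? ∣ S ∣

  hall-from-nonempty : ∀ {d U V} → (∀ S → S ⊆ U → 0 < ∣ S ∣ → ∣ S ∣ ≤ ∣ neighbours V S ∣ + d)
    → HallCondition d U V
  hall-from-nonempty hall S S⊆U with 0 <? ∣ S ∣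
  ... | yes 0<∣S∣ = hall S S⊆U 0<∣S∣
  ... | no 0≮∣S∣ = ≤-trans (≮⇒≥ 0≮∣S∣) z≤n

  hall-inside-critical : ∀ {d U V S} → HallCondition d U V → S ⊆ U → HallCondition d S (neighbours V S)
  hall-inside-critical {d} hall S⊆U T T⊆S =
    ≤-trans (hall T (⊆-trans T⊆S S⊆U)) (+-monoˡ-≤ d (p⊆q⇒∣p∣≤∣q∣ (neighbours-restrict T⊆S)))

  hall-outside-critical : ∀ {d U V S} → HallCondition d U V → S ⊆ U → ∣ neighbours V S ∣ + d ≤ ∣ S ∣
    → HallCondition 0 (U ─ S) (V ─ neighbours V S)
  hall-outside-critical {d} {U} {V} {S} hall S⊆U deficient T T⊆U─S =
    ≤-trans (+-cancelʳ-≤ ∣ S ∣ _ _ chain) (≤-reflexive (sym (+-identityʳ _)))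
    where
    open ≤-Reasoning
    N′ = neighbours (V ─ neighbours V S)
    chain : ∣ T ∣ + ∣ S ∣ ≤ ∣ N′ T ∣ + ∣ S ∣
    chain = begin
      ∣ T ∣ + ∣ S ∣                              ≤⟨ disjoint⇒∣p∣+∣q∣≤∣p∪q∣ T S (x∈p─q⇒x∉q U S ∘ T⊆U─S) ⟩
      ∣ T ∪ S ∣                                  ≤⟨ hall (T ∪ S) (∪-least (p─q⊆p U S ∘ T⊆U─S) S⊆U) ⟩
      ∣ neighbours V (T ∪ S) ∣ + d               ≤⟨ +-monoˡ-≤ d (p⊆q⇒∣p∣≤∣q∣ (neighbours-∪-⊆ {V} {T} {S})) ⟩
      ∣ N′ T ∪ neighbours V S ∣ + d              ≤⟨ +-monoˡ-≤ d (∣p∪q∣≤∣p∣+∣q∣ (N′ T) _) ⟩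
      ∣ N′ T ∣ + ∣ neighbours V S ∣ + d          ≡⟨ +-assoc ∣ N′ T ∣ _ d ⟩
      ∣ N′ T ∣ + (∣ neighbours V S ∣ + d)        ≤⟨ +-monoʳ-≤ ∣ N′ T ∣ deficient ⟩
      ∣ N′ T ∣ + ∣ S ∣                           ∎

  large-matching-∪ : ∀ {d e U V S N} → S ⊆ U → N ⊆ V
    → LargeMatching d S N → LargeMatching e (U ─ S) (V ─ N) → LargeMatching (e + d) U V
  large-matching-∪ {d} {e} {U} {V} {S} {N} S⊆U N⊆V (M₁ , m₁ , size₁) (M₂ , m₂ , size₂) =
    M₁ ++ M₂ ,
    matching-mono (∪-least S⊆U (p─q⊆p U S)) (∪-least N⊆V (p─q⊆p V N))
      (matching-++ (λ x∈S x∈U─S → x∈p─q⇒x∉q U S x∈U─S x∈S) (λ x∈N x∈V─N → x∈p─q⇒x∉q V N x∈V─N x∈N) m₁ m₂) ,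
    size
    where
    open ≤-Reasoning
    size : ∣ U ∣ ≤ length (M₁ ++ M₂) + (e + d)
    size = begin
      ∣ U ∣                                          ≡⟨ ∣p∣≡∣q∣+∣p─q∣ U S S⊆U ⟩
      ∣ S ∣ + ∣ U ─ S ∣                              ≤⟨ +-mono-≤ size₁ size₂ ⟩
      (length M₁ + d) + (length M₂ + e)              ≡⟨ interchange (length M₁) d (length M₂) e ⟩
      (length M₁ + length M₂) + (d + e)              ≡⟨ cong₂ _+_ (sym (length-++ M₁)) (+-comm d e) ⟩
      length (M₁ ++ M₂) + (e + d)                    ∎

  noncritical⇒surplus : ∀ {d U V u} → ¬ ∃ (Critical d U V) → u ∈ U
    → ∀ T → T ⊆ U - u → 0 < ∣ T ∣ → ∣ T ∣ < ∣ neighbours V T ∣ + d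
  noncritical⇒surplus {U = U} {u = u} noCritical u∈U T T⊆U-u 0<∣T∣ = ≰⇒> λ deficient →
    noCritical (T , p─q⊆p U ⁅ u ⁆ ∘ T⊆U-u , 0<∣T∣ ,
                ≤-<-trans (p⊆q⇒∣p∣≤∣q∣ T⊆U-u) (x∈p⇒∣p-x∣<∣p∣ u∈U) , deficient)

  hall⇒neighbour : ∀ {U V u} → HallCondition 0 U V → u ∈ U → ∃[ v ] v ∈ V × R u v
  hall⇒neighbour {U} {V} {u} hall u∈U = neighbour (0<∣p∣⇒Nonempty (neighbours V ⁅ u ⁆) 0<∣N⁅u⁆∣)
    where
    0<∣N⁅u⁆∣ : 0 < ∣ neighbours V ⁅ u ⁆ ∣
    0<∣N⁅u⁆∣ = subst₂ _≤_ (∣⁅x⁆∣≡1 u) (+-identityʳ _)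
                 (hall ⁅ u ⁆ λ x∈⁅u⁆ → subst (_∈ U) (sym (x∈⁅y⁆⇒x≡y u x∈⁅u⁆)) u∈U)
    neighbour : Nonempty (neighbours V ⁅ u ⁆) → ∃[ v ] v ∈ V × R u v
    neighbour (v , v∈N) with ∈-neighbours⁻ v∈N
    ... | v∈V , u′ , u′∈⁅u⁆ , u′Rv = v , v∈V , subst (λ w → R w v) (x∈⁅y⁆⇒x≡y u u′∈⁅u⁆) u′Rv

  HallBelow : ℕ → Set
  HallBelow m = ∀ d U V → ∣ U ∣ + d < m → HallCondition d U V → LargeMatching d U V

  large-matching-via-critical : ∀ {d U V S} → HallBelow (∣ U ∣ + d) → HallCondition d U V → Critical d U V S
    → LargeMatching d U V
  large-matching-via-critical {d} {U} {V} {S} ih hall (S⊆U , 0<∣S∣ , ∣S∣<∣U∣ , deficient) =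
    large-matching-∪ S⊆U (proj₁ ∘ ∈-neighbours⁻)
      (ih d S (neighbours V S) (+-monoˡ-< d ∣S∣<∣U∣) (hall-inside-critical hall S⊆U))
      (ih 0 (U ─ S) (V ─ neighbours V S) smaller (hall-outside-critical hall S⊆U deficient))
    where
    open ≤-Reasoning
    smaller : ∣ U ─ S ∣ + 0 < ∣ U ∣ + d
    smaller = begin-strict
      ∣ U ─ S ∣ + 0          ≡⟨ +-identityʳ _ ⟩
      ∣ U ─ S ∣              <⟨ +-monoˡ-< ∣ U ─ S ∣ 0<∣S∣ ⟩
      ∣ S ∣ + ∣ U ─ S ∣      ≡⟨ ∣p∣≡∣q∣+∣p─q∣ U S S⊆U ⟨
      ∣ U ∣                  ≤⟨ m≤m+n ∣ U ∣ d ⟩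
      ∣ U ∣ + d              ∎

  large-matching-dropping-vertex : ∀ {e U V u} → HallBelow (∣ U ∣ + suc e) → ¬ ∃ (Critical (suc e) U V) → u ∈ U
    → LargeMatching (suc e) U V
  large-matching-dropping-vertex {e} {U} {V} {u} ih noCritical u∈U = extend (ih e (U - u) V smaller hall′)
    where
    open ≤-Reasoning
    smaller : ∣ U - u ∣ + e < ∣ U ∣ + suc e
    smaller = +-mono-<-≤ (x∈p⇒∣p-x∣<∣p∣ u∈U) (n≤1+n e)
    hall′ : HallCondition e (U - u) V
    hall′ = hall-from-nonempty λ T T⊆U-u 0<∣T∣ →
      ≤-pred (subst (suc ∣ T ∣ ≤_) (+-suc _ e) (noncritical⇒surplus noCritical u∈U T T⊆U-u 0<∣T∣))
    extend : LargeMatching e (U - u) V → LargeMatching (suc e) U V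
    extend (M , m , size) = M , matching-mono (p─q⊆p U ⁅ u ⁆) ⊆-refl m , (begin
      ∣ U ∣                 ≡⟨ x∈p⇒∣p∣≡1+∣p-x∣ U u∈U ⟩
      suc ∣ U - u ∣         ≤⟨ s≤s size ⟩
      suc (length M + e)    ≡⟨ +-suc (length M) e ⟨
      length M + suc e      ∎)

  large-matching-adding-arc : ∀ {U V u} → HallBelow (∣ U ∣ + 0) → HallCondition 0 U V → ¬ ∃ (Critical 0 U V) → u ∈ U
    → LargeMatching 0 U V
  large-matching-adding-arc {U} {V} {u} ih hall noCritical u∈U with hall⇒neighbour hall u∈U
  ... | v , v∈V , uRv =
    large-matching-∪ ⁅u⁆⊆U ⁅v⁆⊆V
      ((u , v) ∷ [] , ((x∈⁅x⁆ u , x∈⁅x⁆ v , uRv) ∷ [] , [] ∷ []) , ≤-reflexive (∣⁅x⁆∣≡1 u))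
      (ih 0 (U - u) (V - v) smaller hall′)
    where
    open ≤-Reasoning
    ⁅u⁆⊆U : ⁅ u ⁆ ⊆ U
    ⁅u⁆⊆U x∈⁅u⁆ = subst (_∈ U) (sym (x∈⁅y⁆⇒x≡y u x∈⁅u⁆)) u∈U
    ⁅v⁆⊆V : ⁅ v ⁆ ⊆ V
    ⁅v⁆⊆V x∈⁅v⁆ = subst (_∈ V) (sym (x∈⁅y⁆⇒x≡y v x∈⁅v⁆)) v∈V
    smaller : ∣ U - u ∣ + 0 < ∣ U ∣ + 0
    smaller = +-monoˡ-< 0 (x∈p⇒∣p-x∣<∣p∣ u∈U)
    hall′ : HallCondition 0 (U - u) (V - v)
    hall′ = hall-from-nonempty λ T T⊆U-u 0<∣T∣ → let N′ = neighbours (V - v) T in ≤-pred (begin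
      suc ∣ T ∣                          ≤⟨ noncritical⇒surplus noCritical u∈U T T⊆U-u 0<∣T∣ ⟩
      ∣ neighbours V T ∣ + 0             ≡⟨ +-identityʳ _ ⟩
      ∣ neighbours V T ∣                 ≤⟨ p⊆q⇒∣p∣≤∣q∣ (neighbours-⊆-∪ {V} {T} {⁅ v ⁆}) ⟩
      ∣ N′ ∪ ⁅ v ⁆ ∣                     ≤⟨ ∣p∪q∣≤∣p∣+∣q∣ N′ ⁅ v ⁆ ⟩
      ∣ N′ ∣ + ∣ ⁅ v ⁆ ∣                 ≡⟨ cong (∣ N′ ∣ +_) (∣⁅x⁆∣≡1 v) ⟩
      ∣ N′ ∣ + 1                         ≡⟨ +-comm ∣ N′ ∣ 1 ⟩
      suc ∣ N′ ∣                         ≡⟨ cong suc (+-identityʳ ∣ N′ ∣) ⟨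
      suc (∣ N′ ∣ + 0)                   ∎)

  -- Split along a critical set if there is one; otherwise every nonempty proper
  -- subset has surplus, so a vertex (d > 0) or an arc (d = 0) can be removed.
  large-matching-step : ∀ d U V → HallBelow (∣ U ∣ + d) → HallCondition d U V → LargeMatching d U V
  large-matching-step d U V ih hall with 0 <? ∣ U ∣
  ... | no 0≮∣U∣ = [] , ([] , []) , ≤-trans (≮⇒≥ 0≮∣U∣) z≤n
  ... | yes 0<∣U∣ with anySubset? (critical? d U V) | 0<∣p∣⇒Nonempty U 0<∣U∣
  ...   | yes (S , critical) | _ = large-matching-via-critical ih hall critical
  ...   | no noCritical | u , u∈U with d
  ...     | zero = large-matching-adding-arc ih hall noCritical u∈U
  ...     | suc e = large-matching-dropping-vertex ih noCritical u∈U

  defect-hall : ∀ d U V → HallCondition d U V → LargeMatching d U V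
  defect-hall d U V = go d U V (<-wellFounded (∣ U ∣ + d))
    where
    go : ∀ d U V → Acc _<_ (∣ U ∣ + d) → HallCondition d U V → LargeMatching d U V
    go d U V (acc smaller) = large-matching-step d U V λ d′ U′ V′ lt → go d′ U′ V′ (smaller lt)

  maximal-deficiency : ∀ d → HallCondition d ⊤ ⊤ → ∃[ e ] HallCondition e ⊤ ⊤ × ∃[ S ] ∣ neighbours ⊤ S ∣ + e ≤ ∣ S ∣
  maximal-deficiency zero hall = 0 , hall , ⊥ , ≤-trans (≤-reflexive (+-identityʳ _)) (p⊆q⇒∣p∣≤∣q∣ N⊥⊆⊥)
    where
    N⊥⊆⊥ : neighbours ⊤ ⊥ ⊆ ⊥
    N⊥⊆⊥ v∈N = contradiction (proj₁ (proj₂ (proj₂ (∈-neighbours⁻ v∈N)))) ∉⊥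
  maximal-deficiency (suc e) hall with anySubset? (λ S → ∣ neighbours ⊤ S ∣ + e <? ∣ S ∣)
  ... | yes (S , lt) = suc e , hall , S , subst (_≤ ∣ S ∣) (sym (+-suc _ e)) lt
  ... | no none = maximal-deficiency e λ S _ → ≮⇒≥ λ lt → none (S , lt)

  record VertexCoverByMatching : Set where
    field
      tails heads : Subset n
      covers : ∀ {u v} → R u v → u ∈ tails ⊎ v ∈ heads
      matching : List (Fin n × Fin n)
      independent : IndependentArcs R matching
      cover≤matching : ∣ tails ∣ + ∣ heads ∣ ≤ length matching

  -- For S of maximal deficiency d, the cover (⊤ ─ S, N(S)) has size n − d, while
  -- Hall's condition with deficiency d yields a matching of size at least n − d.
  könig : VertexCoverByMatching
  könig with maximal-deficiency n (λ S _ → ≤-trans (∣p∣≤n S) (m≤n+m n _))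
  ... | d , hall , S , deficient with defect-hall d ⊤ ⊤ hall
  ... | M , (arcs , indep) , size = record
    { tails = ⊤ ─ S
    ; heads = neighbours ⊤ S
    ; covers = covers
    ; matching = M
    ; independent = All.map (proj₂ ∘ proj₂) arcs , indep
    ; cover≤matching = +-cancelʳ-≤ d _ _ (begin
        ∣ ⊤ ─ S ∣ + ∣ neighbours ⊤ S ∣ + d      ≡⟨ +-assoc ∣ ⊤ ─ S ∣ _ d ⟩
        ∣ ⊤ ─ S ∣ + (∣ neighbours ⊤ S ∣ + d)    ≤⟨ +-monoʳ-≤ ∣ ⊤ ─ S ∣ deficient ⟩
        ∣ ⊤ ─ S ∣ + ∣ S ∣                       ≡⟨ +-comm ∣ ⊤ ─ S ∣ ∣ S ∣ ⟩
        ∣ S ∣ + ∣ ⊤ ─ S ∣                       ≡⟨ ∣p∣≡∣q∣+∣p─q∣ ⊤ S ⊆⊤ ⟨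
        ∣ ⊤ {n} ∣                               ≤⟨ size ⟩
        length M + d                            ∎)
    }
    where
    open ≤-Reasoning
    covers : ∀ {u v} → R u v → u ∈ ⊤ ─ S ⊎ v ∈ neighbours ⊤ S
    covers {u} uRv with u ∈? S
    ... | yes u∈S = inj₂ (∈-neighbours⁺ ∈⊤ u∈S uRv)
    ... | no u∉S = inj₁ (x∈p∧x∉q⇒x∈p─q ∈⊤ u∉S)

-- Counting states

concatMap-map≡cartesianProductWith : ∀ {A B C : Set} (f : A → B → C) xs ys
  → concatMap (λ x → map (f x) ys) xs ≡ cartesianProductWith f xs ys
concatMap-map≡cartesianProductWith f [] ys = refl
concatMap-map≡cartesianProductWith f (x ∷ xs) ys =
  cong (map (f x) ys ++_) (concatMap-map≡cartesianProductWith f xs ys)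

length-cartesianProductWith : ∀ {A B C : Set} (f : A → B → C) xs ys
  → length (cartesianProductWith f xs ys) ≡ length xs * length ys
length-cartesianProductWith f [] ys = refl
length-cartesianProductWith f (x ∷ xs) ys =
  trans (length-++ (map (f x) ys)) (cong₂ _+_ (length-map (f x) ys) (length-cartesianProductWith f xs ys))

allStates-suc : ∀ q n → allStates q (suc n) ≡ cartesianProductWith _∷_ (allFin q) (allStates q n)
allStates-suc q n = concatMap-map≡cartesianProductWith _∷_ (allFin q) (allStates q n)

∈-allStates : ∀ {q n} (x : State q n) → x ∈ₗ allStates q n
∈-allStates [] = here refl
∈-allStates {q} {suc n} (a ∷ x) =
  subst (a ∷ x ∈ₗ_) (sym (allStates-suc q n)) (∈-cartesianProductWith⁺ _∷_ (∈-allFin a) (∈-allStates x))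

allStates-unique : ∀ q n → Unique (allStates q n)
allStates-unique q zero = [] ∷ []
allStates-unique q (suc n) = subst Unique (sym (allStates-suc q n))
  (Unique.cartesianProductWith⁺ _∷_ Vec.∷-injective (Unique.allFin⁺ q) (allStates-unique q n))

length-allStates : ∀ q n → length (allStates q n) ≡ q ^ n
length-allStates q zero = refl
length-allStates q (suc n) = begin
  length (allStates q (suc n))                               ≡⟨ cong length (allStates-suc q n) ⟩
  length (cartesianProductWith _∷_ (allFin q) (allStates q n)) ≡⟨ length-cartesianProductWith _∷_ (allFin q) _ ⟩
  length (allFin q) * length (allStates q n)                 ≡⟨ cong₂ _*_ (length-tabulate {n = q} id) (length-allStates q n) ⟩
  q * q ^ n                                                  ∎
  where open ≡-Reasoning

∈-─⁺ : ∀ {x y : X} {xs} (x∈xs : x ∈ₗ xs) → y ∈ₗ xs → x ≢ y → y ∈ₗ Any._─_ xs x∈xs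
∈-─⁺ (here refl) (here refl) x≢y = contradiction refl x≢y
∈-─⁺ (here refl) (there y∈xs) _ = y∈xs
∈-─⁺ (there x∈xs) (here refl) _ = here refl
∈-─⁺ (there x∈xs) (there y∈xs) x≢y = there (∈-─⁺ x∈xs y∈xs x≢y)

unique-⊆⇒length≤ : ∀ {xs ys : List X} → Unique xs → (∀ {x} → x ∈ₗ xs → x ∈ₗ ys) → length xs ≤ length ys
unique-⊆⇒length≤ {xs = []} _ _ = z≤n
unique-⊆⇒length≤ {xs = x ∷ xs} {ys} (x∉xs ∷ unique) xs⊆ys = begin
  suc (length xs)                  ≤⟨ s≤s (unique-⊆⇒length≤ unique λ y∈xs →
                                         ∈-─⁺ x∈ys (xs⊆ys (there y∈xs)) (All.lookup x∉xs y∈xs)) ⟩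
  suc (length (Any._─_ ys x∈ys))   ≡⟨ length-removeAt′ ys (Any.index x∈ys) ⟨
  length ys                        ∎
  where
  open ≤-Reasoning
  x∈ys = xs⊆ys (here refl)

restrict : ∀ (S : Subset n) → Vec X n → Vec X ∣ S ∣
restrict [] [] = []
restrict (inside ∷ S) (a ∷ x) = a ∷ restrict S x
restrict (outside ∷ S) (_ ∷ x) = restrict S x

restrict-≡⇒lookup-≡ : ∀ (S : Subset n) {x y : Vec X n} → restrict S x ≡ restrict S y
  → ∀ {i} → i ∈ S → lookup x i ≡ lookup y i
restrict-≡⇒lookup-≡ (inside ∷ S) {_ ∷ _} {_ ∷ _} eq here = Vec.∷-injectiveˡ eq
restrict-≡⇒lookup-≡ (inside ∷ S) {_ ∷ _} {_ ∷ _} eq (there i∈S) = restrict-≡⇒lookup-≡ S (Vec.∷-injectiveʳ eq) i∈S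
restrict-≡⇒lookup-≡ (outside ∷ S) {_ ∷ _} {_ ∷ _} eq (there i∈S) = restrict-≡⇒lookup-≡ S eq i∈S

module _ {q n : ℕ} {K : Set} (_≟ₖ_ : DecidableEquality K) (g : State q n → State q n) (key : State q n → K)
         (g-factors : ∀ {x y} → key x ≡ key y → g x ≡ g y) where

  private
    fromKey : K → Maybe (State q n)
    fromKey k with any? (λ x → key x ≟ₖ k) (allStates q n)
    ... | yes found = just (g (proj₁ (Any.satisfied found)))
    ... | no _ = nothing

    fromKey-key : ∀ x → fromKey (key x) ≡ just (g x)
    fromKey-key x with any? (λ x′ → key x′ ≟ₖ key x) (allStates q n)
    ... | yes found = cong just (g-factors (proj₂ (Any.satisfied found)))
    ... | no none = contradiction (lose (∈-allStates x) refl) none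

  imageSize≤length-keys : ∀ keys → (∀ x → key x ∈ₗ keys) → imageSize g ≤ length keys
  imageSize≤length-keys keys key∈keys = begin
    imageSize g                        ≤⟨ unique-⊆⇒length≤ (Unique.filter⁺ isImage? (allStates-unique q n)) image⊆ ⟩
    length (mapMaybe fromKey keys)     ≤⟨ length-catMaybes (map fromKey keys) ⟩
    length (map fromKey keys)          ≡⟨ length-map fromKey keys ⟩
    length keys                        ∎
    where
    open ≤-Reasoning
    isImage? : Decidable λ y → Any (λ x → g x ≡ y) (allStates q n)
    isImage? y = any? (λ x → Vec.≡-dec _≟_ (g x) y) (allStates q n)
    image⊆ : ∀ {y} → y ∈ₗ filter isImage? (allStates q n) → y ∈ₗ mapMaybe fromKey keys
    image⊆ y∈image with Any.satisfied (proj₂ (∈-filter⁻ isImage? {xs = allStates q n} y∈image))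
    ... | x , refl = mapMaybe⁺ fromKey keys (map⁺ (Any.map
      (λ { refl → subst (Maybe.Any (g x ≡_)) (sym (fromKey-key x)) (Maybe.just refl) }) (key∈keys x)))

imageSize≤^∣A∣+∣B∣ : ∀ {q n} (g : State q n → State q n) (A B : Subset n)
  → (∀ {x y} → restrict A x ≡ restrict A y → restrict B (g x) ≡ restrict B (g y) → g x ≡ g y)
  → imageSize g ≤ q ^ (∣ A ∣ + ∣ B ∣)
imageSize≤^∣A∣+∣B∣ {q} g A B determined = begin
  imageSize g                                          ≤⟨ imageSize≤length-keys _≟ₖ_ g key factors keys key∈keys ⟩
  length keys                                          ≡⟨ length-cartesianProductWith _,_ (allStates q ∣ A ∣) _ ⟩
  length (allStates q ∣ A ∣) * length (allStates q ∣ B ∣) ≡⟨ cong₂ _*_ (length-allStates q ∣ A ∣) (length-allStates q ∣ B ∣) ⟩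
  q ^ ∣ A ∣ * q ^ ∣ B ∣                                  ≡⟨ ^-distribˡ-+-* q ∣ A ∣ ∣ B ∣ ⟨
  q ^ (∣ A ∣ + ∣ B ∣)                                    ∎
  where
  open ≤-Reasoning
  _≟ₖ_ = Product.≡-dec (Vec.≡-dec _≟_) (Vec.≡-dec _≟_)
  key = λ x → restrict A x , restrict B (g x)
  keys = cartesianProduct (allStates q ∣ A ∣) (allStates q ∣ B ∣)
  factors : ∀ {x y} → key x ≡ key y → g x ≡ g y
  factors eq = determined (proj₁ (,-injective eq)) (proj₂ (,-injective eq))
  key∈keys : ∀ x → key x ∈ₗ keys
  key∈keys x = ∈-cartesianProduct⁺ (∈-allStates _) (∈-allStates _)

-- Schedules

update-∈ : ∀ {q n} (f : State q n → State q n) {S x v} → v ∈ S → lookup (update f S x) v ≡ lookup (f x) v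
update-∈ f {x = a ∷ x} here with f (a ∷ x)
... | _ ∷ _ = refl
update-∈ f {x = a ∷ x} (there v∈S) with f (a ∷ x)
... | _ ∷ fx = update-∈ (λ _ → fx) v∈S

update-∉ : ∀ {q n} (f : State q n → State q n) {S x v} → v ∉ S → lookup (update f S x) v ≡ lookup x v
update-∉ f {outside ∷ S} {a ∷ x} {zero} v∉S with f (a ∷ x)
... | _ ∷ _ = refl
update-∉ f {inside ∷ S} {a ∷ x} {zero} v∉S = contradiction here v∉S
update-∉ f {_ ∷ S} {a ∷ x} {suc v} v∉S with f (a ∷ x)
... | _ ∷ fx = update-∉ (λ _ → fx) (v∉S ∘ there)

Unscheduled : ∀ {t} → Vec (Subset n) t → Fin n → Set
Unscheduled σ v = ∀ i → v ∉ lookup σ i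

PairwiseDisjoint : ∀ {t} → Vec (Subset n) t → Set
PairwiseDisjoint σ = ∀ i j v → v ∈ lookup σ i → v ∈ lookup σ j → i ≡ j

module _ {q n : ℕ} (f : State q n → State q n) where

  applySchedule-unscheduled : ∀ {t} (σ : Vec (Subset n) t) {x v} → Unscheduled σ v
    → lookup (applySchedule f σ x) v ≡ lookup x v
  applySchedule-unscheduled [] _ = refl
  applySchedule-unscheduled (S ∷ σ) unscheduled =
    trans (applySchedule-unscheduled σ (unscheduled ∘ suc)) (update-∉ f (unscheduled zero))

  applySchedule-determined : ∀ {t} (A B : Subset n)
    → (∀ {v} → v ∉ B → ∀ x y → (∀ {u} → u ∈ A → lookup x u ≡ lookup y u) → lookup (f x) v ≡ lookup (f y) v)
    → (σ : Vec (Subset n) t) → PairwiseDisjoint σ → ∀ {x y}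
    → (∀ {v} → v ∈ A ⊎ Unscheduled σ v → lookup x v ≡ lookup y v)
    → (∀ {v} → v ∈ B → lookup (applySchedule f σ x) v ≡ lookup (applySchedule f σ y) v)
    → applySchedule f σ x ≡ applySchedule f σ y
  applySchedule-determined A B local [] _ agree _ = Pointwise-≡⇒≡ (ext λ v → agree (inj₂ λ ()))
  applySchedule-determined A B local (S ∷ σ) disjoint {x} {y} agree final =
    applySchedule-determined A B local σ (λ i j v v∈σᵢ v∈σⱼ → Fin.suc-injective (disjoint (suc i) (suc j) v v∈σᵢ v∈σⱼ))
      agree′ final
    where
    agree′ : ∀ {v} → v ∈ A ⊎ Unscheduled σ v → lookup (update f S x) v ≡ lookup (update f S y) v
    agree′ {v} A⊎unscheduled with v ∈? S
    ... | no v∉S = trans (update-∉ f v∉S) (trans (agree (map₂ unscheduled-now A⊎unscheduled)) (sym (update-∉ f v∉S)))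
      where
      unscheduled-now : Unscheduled σ v → Unscheduled (S ∷ σ) v
      unscheduled-now _ zero = v∉S
      unscheduled-now unscheduled (suc i) = unscheduled i
    ... | yes v∈S with v ∈? B
    ...   | yes v∈B = trans (sym (applySchedule-unscheduled σ later)) (trans (final v∈B) (applySchedule-unscheduled σ later))
      where
      later : Unscheduled σ v
      later i v∈σᵢ with () ← disjoint zero (suc i) v v∈S v∈σᵢ
    ...   | no v∉B = trans (update-∈ f v∈S) (trans (local v∉B x y (agree ∘ inj₁)) (sym (update-∈ f v∈S)))

-- Interaction graphs

dependsOn? : ∀ {q n} (f : State q n → State q n) u v → Dec (DependsOn f u v)
dependsOn? {q} {n} f u v =
  map′ Any.satisfied (λ (x , a , changes) → lose (∈-allStates x) (a , changes))
    (any? (λ x → Fin.any? λ a → ¬? (lookup (f x) v ≟ lookup (f (x [ u ]≔ a)) v)) (allStates q n))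

module _ {q n} {f : State q n → State q n} {D : Digraph n} (ig : HasInteractionGraph f D) where

  interactionGraph? : ∀ u v → Dec (D u v)
  interactionGraph? u v = map′ (proj₂ (ig u v)) (proj₁ (ig u v)) (dependsOn? f u v)

  non-arc⇒update-invariant : ∀ {u v} → ¬ D u v → ∀ x a → lookup (f (x [ u ]≔ a)) v ≡ lookup (f x) v
  non-arc⇒update-invariant {u} {v} ¬uDv x a with lookup (f (x [ u ]≔ a)) v ≟ lookup (f x) v
  ... | yes unchanged = unchanged
  ... | no changed = contradiction (proj₂ (ig u v) (x , a , changed ∘ sym)) ¬uDv

  lookup-f-cong : ∀ v x y → (∀ {u} → D u v → lookup x u ≡ lookup y u) → lookup (f x) v ≡ lookup (f y) v
  lookup-f-cong v x y agree = go (allFin n) x (λ u∉ → contradiction (∈-allFin _) u∉) agree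
    where
    patch : ∀ (x : State q n) w u → u ≡ w ⊎ lookup x u ≡ lookup y u → lookup (x [ w ]≔ lookup y w) u ≡ lookup y u
    patch x w u (inj₁ refl) = Vec.lookup∘update u x (lookup y u)
    patch x w u (inj₂ eq) with u ≟ w
    ... | yes refl = Vec.lookup∘update u x (lookup y u)
    ... | no u≢w = trans (Vec.lookup∘update′ u≢w x _) eq
    go : ∀ (L : List (Fin n)) x → (∀ {u} → ¬ u ∈ₗ L → lookup x u ≡ lookup y u)
      → (∀ {u} → D u v → lookup x u ≡ lookup y u) → lookup (f x) v ≡ lookup (f y) v
    go [] x agreeOutside _ = cong (λ z → lookup (f z) v) (Pointwise-≡⇒≡ (ext λ u → agreeOutside λ ()))
    go (w ∷ L) x agreeOutside inN = trans step (go L (x [ w ]≔ lookup y w) agreeOutside′ λ uDv → patch x w _ (inj₂ (inN uDv)))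
      where
      agreeOutside′ : ∀ {u} → ¬ u ∈ₗ L → lookup (x [ w ]≔ lookup y w) u ≡ lookup y u
      agreeOutside′ {u} u∉L with u ≟ w
      ... | yes u≡w = patch x w u (inj₁ u≡w)
      ... | no u≢w = patch x w u (inj₂ (agreeOutside λ { (here u≡w) → u≢w u≡w ; (there u∈L) → u∉L u∈L }))
      step : lookup (f x) v ≡ lookup (f (x [ w ]≔ lookup y w)) v
      step with lookup x w ≟ lookup y w
      ... | yes eq = cong (λ z → lookup (f z) v) (sym (trans (cong (x [ w ]≔_) (sym eq)) (Vec.[]≔-lookup x w)))
      ... | no neq = sym (non-arc⇒update-invariant (λ wDv → neq (inN wDv)) x (lookup y w))

  blockSequential-determined : ∀ {t} (A B : Subset n) → (∀ {u v} → D u v → u ∈ A ⊎ v ∈ B)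
    → (σ : Vec (Subset n) t) → BlockSequential σ → ∀ {x y}
    → restrict A x ≡ restrict A y → restrict B (applySchedule f σ x) ≡ restrict B (applySchedule f σ y)
    → applySchedule f σ x ≡ applySchedule f σ y
  blockSequential-determined A B covers σ (scheduled , disjoint) {x₀} {y₀} agreeA agreeB =
    applySchedule-determined f A B local σ disjoint agree (restrict-≡⇒lookup-≡ B agreeB)
    where
    local : ∀ {v} → v ∉ B → ∀ x y → (∀ {u} → u ∈ A → lookup x u ≡ lookup y u) → lookup (f x) v ≡ lookup (f y) v
    local v∉B x y agreeA = lookup-f-cong _ x y λ uDv → agreeA ([ id , (λ v∈B → contradiction v∈B v∉B) ]′ (covers uDv))
    agree : ∀ {v} → v ∈ A ⊎ Unscheduled σ v → lookup x₀ v ≡ lookup y₀ v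
    agree (inj₁ v∈A) = restrict-≡⇒lookup-≡ A agreeA v∈A
    agree {v} (inj₂ unscheduled) = contradiction (proj₂ (scheduled v)) (unscheduled (proj₁ (scheduled v)))

theorem5 : (n q t : ℕ) → 2 ≤ q → (D : Digraph n) → (f : State q n → State q n)
    → HasInteractionGraph f D → (σ : Vec (Subset n) t) → BlockSequential σ
    → (k : ℕ) → IsAlpha1 D k → imageSize (applySchedule f σ) ≤ q ^ k
theorem5 n q t 2≤q D f ig σ blockSequential k (_ , α₁-maximal) = begin
  imageSize (applySchedule f σ)  ≤⟨ imageSize≤^∣A∣+∣B∣ (applySchedule f σ) tails heads
                                      (blockSequential-determined {f = f} ig tails heads covers σ blockSequential) ⟩
  q ^ (∣ tails ∣ + ∣ heads ∣)    ≤⟨ ^-monoʳ-≤ q (≤-trans cover≤matching (α₁-maximal matching independent)) ⟩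
  q ^ k                          ∎
  where
  open ≤-Reasoning
  open König D (interactionGraph? {f = f} ig)
  open VertexCoverByMatching könig
  instance
    q≢0 : NonZero q
    q≢0 = >-nonZero (≤-trans (s≤s z≤n) 2≤q)
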